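{- Let $n\ge 1$ and let $A^1,A^2,\ldots,A^n$ be finite simple graphs containing no isolated vertices. Then \[ \prod_{i=1}^{n}\gamma_t(A^i) \le n\,\gamma_t(A^1\Box A^2\Box\cdots\Box A^n). \]
   Context: All graphs are finite, simple and undirected. For a graph $G$ and vertex $v$, $N_G(v)$ denotes the open neighborhood of $v$. A total dominating set of $G$ is a set $D\subseteq V(G)$ with $N_G(v)\cap D\neq\emptyset$ for all $v\in V(G)$; $\gamma_t(G)$ is the minimum size of a total dominating set. The Cartesian product $A^1\Box\cdots\Box A^n$ has vertex set $V(A^1)\times\cdots\times V(A^n)$, with $u^1\cdots u^n$ and $v^1\cdots v^n$ adjacent iff for some index $i$, $u^iv^i\in E(A^i)$ and $u^j=v^j$ for all $j\neq i$. -}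

module Defs where

open import Data.Nat using (ℕ; zero; suc; _*_; _≤_)
open import Data.Fin using (Fin; zero; suc)
open import Data.List using (List; length)
open import Data.List.Membership.Propositional using (_∈_)
open import Data.List.Relation.Unary.Unique.Propositional using (Unique)
open import Data.Product using (Σ; ∃; _×_)
open import Relation.Binary.PropositionalEquality using (_≡_; _≢_)
open import Relation.Nullary using (¬_)

record Graph : Set₁ where
  field
    order  : ℕ
    Adj    : Fin order → Fin order → Set
    sym    : ∀ {u v} → Adj u v → Adj v u
    irrefl : ∀ {v} → ¬ Adj v v
open Graph public

NoIsolated : Graph → Set
NoIsolated G = ∀ (v : Fin (order G)) → ∃ λ u → Adj G v u

IsTotalDominating : {V : Set} → (V → V → Set) → List V → Set
IsTotalDominating {V} E D = Unique D × (∀ (v : V) → ∃ λ u → u ∈ D × E v u)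

IsTotalDominationNumber : {V : Set} → (V → V → Set) → ℕ → Set
IsTotalDominationNumber {V} E k =
  (∃ λ (D : List V) → IsTotalDominating E D × length D ≡ k)
  × (∀ (D : List V) → IsTotalDominating E D → k ≤ length D)

BoxVertex : {n : ℕ} → (Fin n → Graph) → Set
BoxVertex {n} A = (i : Fin n) → Fin (order (A i))

BoxAdj : {n : ℕ} → (A : Fin n → Graph) → BoxVertex A → BoxVertex A → Set
BoxAdj {n} A u v =
  ∃ λ (i : Fin n) → Adj (A i) (u i) (v i) × (∀ (j : Fin n) → j ≢ i → u j ≡ v j)

prodFin : {n : ℕ} → (Fin n → ℕ) → ℕ
prodFin {zero}  f = 1
prodFin {suc n} f = f zero * prodFin (λ i → f (suc i))

-- A minimum total dominating set U = u₀ … u_{k-1} of a graph G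
-- (k = γ_t(G)) partitions V(G): v lies in part j when u_j is a chosen
-- neighbour of v.  This partition packs: if a list E dominates every vertex
-- of the parts in a set S, then |S| ≤ |E|, because E together with the u_j of
-- the other parts is total dominating (DominationPartition).
-- The product of these partitions cuts the product graph into a grid of
-- γ_t(A¹) ⋯ γ_t(Aⁿ) cells.  The main bound (cellBound) says: if D dominates
-- every vertex of the cells in S, then |S| ≤ m · |D|, m the number of factors.
-- It is proved by induction on m (module InductionStep): for each cell J of
-- the last m factors, packing in the first factor bounds the cells (·, J) of
-- S by the first coordinates of D over J plus a neighbour of every vertex h
-- of the first factor not dominated that way; for fixed h those are dominated
-- inside the fibre {h} × …, where the induction hypothesis applies.
-- The theorem is the case S = all cells.  The argument decides adjacency;
-- since the conclusion is decidable, this is obtained by double negation.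

module Submission where

open import Defs hiding (sym)
open import Data.Nat using (ℕ; zero; suc; _+_; _*_; _≤_; z≤n; _≤?_)
open import Data.Nat.Properties
  using (+-identityʳ; +-mono-≤; +-monoʳ-≤; +-cancelʳ-≤;
         *-distribˡ-+; *-zeroʳ; *-identityˡ; *-identityʳ; *-assoc; *-comm;
         +-commutativeSemigroup; module ≤-Reasoning)
open import Algebra.Properties.CommutativeSemigroup +-commutativeSemigroup using (interchange)
open import Data.Bool using (Bool; true; false; _∧_; not; T)
open import Data.Bool.Properties using (∧-identityʳ; T-≡; T-not-≡; T-∧)
open import Data.Fin using (Fin; zero; suc)
open import Data.Fin.Properties using (_≟_; suc-injective)
open import Data.List using (List; []; _∷_; _++_; map; length; lookup; tabulate; allFin; filterᵇ; deduplicate)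
open import Data.Bool.ListAction using (any)
open import Data.List.Properties using (length-++; length-map; length-deduplicate)
open import Data.List.Membership.Propositional using (_∈_; find; lose)
open import Data.List.Membership.Propositional.Properties
  using (∈-map⁺; ∈-++⁺ˡ; ∈-++⁺ʳ; ∈-filter⁺; ∈-allFin; ∈-deduplicate⁺)
open import Data.List.Relation.Unary.Any using (index)
open import Data.List.Relation.Unary.Any.Properties using (lookup-index; any⁺; any⁻)
open import Data.List.Relation.Unary.Unique.DecPropositional.Properties using (deduplicate-!)
open import Data.Product using (∃; _×_; _,_; proj₁; proj₂; uncurry)
open import Data.Product.Properties using (,-injectiveˡ; ,-injectiveʳ)
open import Data.Sum using (_⊎_; inj₁; inj₂)
open import Data.Unit using (⊤; tt)
open import Data.Empty using (⊥; ⊥-elim)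
open import Function using (_∘_)
open import Function.Bundles using (Equivalence)
open import Relation.Binary.Definitions using (Decidable; DecidableEquality)
open import Relation.Binary.PropositionalEquality using (_≡_; refl; sym; trans; cong; cong₂; subst; module ≡-Reasoning)
open import Relation.Nullary using (¬_; Dec; yes; does; _×-dec_)
open import Relation.Nullary.Decidable
  using (map′; T?; toWitness; fromWitness; isYes≗does; decidable-stable; ¬¬-excluded-middle)

open Equivalence using (to; from)

𝟙 : Bool → ℕ
𝟙 true  = 1
𝟙 false = 0

T-not-T : ∀ {b} → T (not b) → T b → ⊥
T-not-T {true}  () _
T-not-T {false} _  ()

T-does⁻ : ∀ {A : Set} (a? : Dec A) → T (does a?) → A
T-does⁻ a? = toWitness ∘ subst T (sym (isYes≗does a?))

T-does⁺ : ∀ {A : Set} (a? : Dec A) → A → T (does a?)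
T-does⁺ a? = subst T (isYes≗does a?) ∘ fromWitness

∑ : {a : ℕ} → (Fin a → ℕ) → ℕ
∑ {zero}  f = 0
∑ {suc a} f = f zero + ∑ (f ∘ suc)

∑-cong : ∀ {a} {f g : Fin a → ℕ} → (∀ i → f i ≡ g i) → ∑ f ≡ ∑ g
∑-cong {zero}  e = refl
∑-cong {suc a} e = cong₂ _+_ (e zero) (∑-cong (e ∘ suc))

∑-mono : ∀ {a} {f g : Fin a → ℕ} → (∀ i → f i ≤ g i) → ∑ f ≤ ∑ g
∑-mono {zero}  e = z≤n
∑-mono {suc a} e = +-mono-≤ (e zero) (∑-mono (e ∘ suc))

∑-const : ∀ a c → ∑ {a} (λ _ → c) ≡ a * c
∑-const zero    c = refl
∑-const (suc a) c = cong (c +_) (∑-const a c)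

∑-zero : ∀ a → ∑ {a} (λ _ → 0) ≡ 0
∑-zero a = trans (∑-const a 0) (*-zeroʳ a)

∑-+ : ∀ {a} (f g : Fin a → ℕ) → ∑ (λ i → f i + g i) ≡ ∑ f + ∑ g
∑-+ {zero}  f g = refl
∑-+ {suc a} f g =
  trans (cong (f zero + g zero +_) (∑-+ (f ∘ suc) (g ∘ suc))) (interchange (f zero) (g zero) _ _)

∑-* : ∀ {a} (c : ℕ) (f : Fin a → ℕ) → ∑ (λ i → c * f i) ≡ c * ∑ f
∑-* {zero}  c f = sym (*-zeroʳ c)
∑-* {suc a} c f = trans (cong (c * f zero +_) (∑-* c (f ∘ suc))) (sym (*-distribˡ-+ c (f zero) _))

∑-point∧ : ∀ {a} (i : Fin a) (b : Bool) → ∑ (λ l → 𝟙 (does (i ≟ l) ∧ b)) ≡ 𝟙 b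
∑-point∧ {suc a} zero    b = trans (cong (𝟙 b +_) (∑-zero a)) (+-identityʳ (𝟙 b))
∑-point∧ {suc a} (suc i) b = ∑-point∧ i b

∑-point : ∀ {a} (i : Fin a) → ∑ (λ l → 𝟙 (does (i ≟ l))) ≡ 1
∑-point i = trans (∑-cong (λ l → cong 𝟙 (sym (∧-identityʳ (does (i ≟ l)))))) (∑-point∧ i true)

∑-complement : ∀ {a} (S : Fin a → Bool) → ∑ (𝟙 ∘ S) + ∑ (𝟙 ∘ not ∘ S) ≡ a
∑-complement {a} S = trans (sym (∑-+ (𝟙 ∘ S) (𝟙 ∘ not ∘ S)))
  (trans (∑-cong (λ i → 𝟙-not (S i))) (trans (∑-const a 1) (*-identityʳ a)))
  where
  𝟙-not : ∀ b → 𝟙 b + 𝟙 (not b) ≡ 1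
  𝟙-not true  = refl
  𝟙-not false = refl

∑ᴸ : {X : Set} → (X → ℕ) → List X → ℕ
∑ᴸ f []       = 0
∑ᴸ f (x ∷ xs) = f x + ∑ᴸ f xs

∑ᴸ-cong : ∀ {X : Set} {f g : X → ℕ} (xs : List X) → (∀ x → f x ≡ g x) → ∑ᴸ f xs ≡ ∑ᴸ g xs
∑ᴸ-cong []       e = refl
∑ᴸ-cong (x ∷ xs) e = cong₂ _+_ (e x) (∑ᴸ-cong xs e)

∑ᴸ-length : ∀ {X : Set} (xs : List X) → ∑ᴸ (λ _ → 1) xs ≡ length xs
∑ᴸ-length []       = refl
∑ᴸ-length (x ∷ xs) = cong suc (∑ᴸ-length xs)

∑ᴸ-tabulate : ∀ {a} {X : Set} (f : X → ℕ) (g : Fin a → X) → ∑ᴸ f (tabulate g) ≡ ∑ (f ∘ g)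
∑ᴸ-tabulate {zero}  f g = refl
∑ᴸ-tabulate {suc a} f g = cong (f (g zero) +_) (∑ᴸ-tabulate f (g ∘ suc))

∑-∑ᴸ : ∀ {a} {X : Set} (f : Fin a → X → ℕ) (xs : List X)
  → ∑ (λ h → ∑ᴸ (f h) xs) ≡ ∑ᴸ (λ x → ∑ (λ h → f h x)) xs
∑-∑ᴸ {a} f []       = ∑-zero a
∑-∑ᴸ     f (x ∷ xs) = trans (∑-+ (λ h → f h x) (λ h → ∑ᴸ (f h) xs))
                           (cong (∑ (λ h → f h x) +_) (∑-∑ᴸ f xs))

length-filterᵇ : ∀ {X : Set} (p : X → Bool) (xs : List X) → length (filterᵇ p xs) ≡ ∑ᴸ (𝟙 ∘ p) xs
length-filterᵇ p []       = refl
length-filterᵇ p (x ∷ xs) with p x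
... | true  = cong suc (length-filterᵇ p xs)
... | false = length-filterᵇ p xs

length-select : ∀ {a} (p : Fin a → Bool) → length (filterᵇ p (allFin a)) ≡ ∑ (𝟙 ∘ p)
length-select {a} p = trans (length-filterᵇ p (allFin a)) (∑ᴸ-tabulate (𝟙 ∘ p) (λ i → i))

-- Grids Fin k₀ × ⋯ × Fin k_{m-1} and sums over them

Grid : {m : ℕ} → (Fin m → ℕ) → Set
Grid {zero}  k = ⊤
Grid {suc m} k = Fin (k zero) × Grid (k ∘ suc)

∑ᴳ : ∀ {m} (k : Fin m → ℕ) → (Grid k → ℕ) → ℕ
∑ᴳ {zero}  k f = f tt
∑ᴳ {suc m} k f = ∑ᴳ (k ∘ suc) (λ J → ∑ (λ l → f (l , J)))

∑ᴳ-cong : ∀ {m} (k : Fin m → ℕ) {f g : Grid k → ℕ} → (∀ J → f J ≡ g J) → ∑ᴳ k f ≡ ∑ᴳ k g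
∑ᴳ-cong {zero}  k e = e tt
∑ᴳ-cong {suc m} k e = ∑ᴳ-cong (k ∘ suc) (λ J → ∑-cong (λ l → e (l , J)))

∑ᴳ-mono : ∀ {m} (k : Fin m → ℕ) {f g : Grid k → ℕ} → (∀ J → f J ≤ g J) → ∑ᴳ k f ≤ ∑ᴳ k g
∑ᴳ-mono {zero}  k e = e tt
∑ᴳ-mono {suc m} k e = ∑ᴳ-mono (k ∘ suc) (λ J → ∑-mono (λ l → e (l , J)))

∑ᴳ-+ : ∀ {m} (k : Fin m → ℕ) (f g : Grid k → ℕ) → ∑ᴳ k (λ J → f J + g J) ≡ ∑ᴳ k f + ∑ᴳ k g
∑ᴳ-+ {zero}  k f g = refl
∑ᴳ-+ {suc m} k f g = trans (∑ᴳ-cong (k ∘ suc) (λ J → ∑-+ (λ l → f (l , J)) (λ l → g (l , J))))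
                           (∑ᴳ-+ (k ∘ suc) _ _)

∑ᴳ-const : ∀ {m} (k : Fin m → ℕ) (c : ℕ) → ∑ᴳ k (λ _ → c) ≡ prodFin k * c
∑ᴳ-const {zero}  k c = sym (*-identityˡ c)
∑ᴳ-const {suc m} k c = begin
  ∑ᴳ (k ∘ suc) (λ _ → ∑ {k zero} (λ _ → c)) ≡⟨ ∑ᴳ-cong (k ∘ suc) (λ _ → ∑-const (k zero) c) ⟩
  ∑ᴳ (k ∘ suc) (λ _ → k zero * c)           ≡⟨ ∑ᴳ-const (k ∘ suc) (k zero * c) ⟩
  prodFin (k ∘ suc) * (k zero * c)           ≡⟨ sym (*-assoc (prodFin (k ∘ suc)) (k zero) c) ⟩
  prodFin (k ∘ suc) * k zero * c             ≡⟨ cong (_* c) (*-comm (prodFin (k ∘ suc)) (k zero)) ⟩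
  k zero * prodFin (k ∘ suc) * c             ∎
  where open ≡-Reasoning

∑ᴳ-zero : ∀ {m} (k : Fin m → ℕ) → ∑ᴳ k (λ _ → 0) ≡ 0
∑ᴳ-zero k = trans (∑ᴳ-const k 0) (*-zeroʳ (prodFin k))

∑ᴳ-∑ : ∀ {m} (k : Fin m → ℕ) {a : ℕ} (f : Grid k → Fin a → ℕ)
  → ∑ᴳ k (λ J → ∑ (f J)) ≡ ∑ (λ h → ∑ᴳ k (λ J → f J h))
∑ᴳ-∑ k {zero}  f = ∑ᴳ-zero k
∑ᴳ-∑ k {suc a} f = trans (∑ᴳ-+ k (λ J → f J zero) (λ J → ∑ (f J ∘ suc)))
                         (cong (∑ᴳ k (λ J → f J zero) +_) (∑ᴳ-∑ k (λ J → f J ∘ suc)))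

∑ᴳ-∑ᴸ : ∀ {m} (k : Fin m → ℕ) {X : Set} (f : Grid k → X → ℕ) (xs : List X)
  → ∑ᴳ k (λ J → ∑ᴸ (f J) xs) ≡ ∑ᴸ (λ x → ∑ᴳ k (λ J → f J x)) xs
∑ᴳ-∑ᴸ k f []       = ∑ᴳ-zero k
∑ᴳ-∑ᴸ k f (x ∷ xs) = trans (∑ᴳ-+ k (λ J → f J x) (λ J → ∑ᴸ (f J) xs))
                           (cong (∑ᴳ k (λ J → f J x) +_) (∑ᴳ-∑ᴸ k f xs))

gridEq? : ∀ {m} (k : Fin m → ℕ) → DecidableEquality (Grid k)
gridEq? {zero}  k tt tt = yes refl
gridEq? {suc m} k (a , x) (b , y) =
  map′ (uncurry (cong₂ _,_)) (λ e → ,-injectiveˡ e , ,-injectiveʳ e) ((a ≟ b) ×-dec gridEq? (k ∘ suc) x y)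

∑ᴳ-point : ∀ {m} (k : Fin m → ℕ) (c : Grid k) → ∑ᴳ k (λ J → 𝟙 (does (gridEq? k c J))) ≡ 1
∑ᴳ-point {zero}  k c = refl
∑ᴳ-point {suc m} k (a , c) =
  trans (∑ᴳ-cong (k ∘ suc) (λ J → ∑-point∧ a (does (gridEq? (k ∘ suc) c J)))) (∑ᴳ-point (k ∘ suc) c)

-- Domination partitions

record DominationPartition (G : Graph) (k : ℕ) : Set where
  field
    part    : Fin (order G) → Fin k
    packing : (S : Fin k → Bool) (E : List (Fin (order G)))
            → (∀ v → T (S (part v)) → ∃ λ u → u ∈ E × Adj G v u)
            → ∑ (𝟙 ∘ S) ≤ length E

-- Every graph has a domination partition into γ_t parts: v lies in the part
-- of its chosen neighbour in a minimum total dominating set U.  If E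
-- dominates the parts in S, then E followed by the U-vertices of the other
-- parts is total dominating, so γ_t ≤ |E| + (γ_t − |S|).
dominationPartition : (G : Graph) (g : ℕ) → IsTotalDominationNumber (Adj G) g → DominationPartition G g
dominationPartition G _ ((U , (_ , dominatesU) , refl) , minimal) = record { part = part ; packing = packing }
  where
  part : Fin (order G) → Fin (length U)
  part v = index (proj₁ (proj₂ (dominatesU v)))

  adjacent-part : ∀ v → Adj G v (lookup U (part v))
  adjacent-part v =
    subst (Adj G v) (lookup-index (proj₁ (proj₂ (dominatesU v)))) (proj₂ (proj₂ (dominatesU v)))

  packing : (S : Fin (length U) → Bool) (E : List (Fin (order G)))
          → (∀ v → T (S (part v)) → ∃ λ u → u ∈ E × Adj G v u)
          → ∑ (𝟙 ∘ S) ≤ length E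
  packing S E dominatesS = +-cancelʳ-≤ (∑ (𝟙 ∘ not ∘ S)) (∑ (𝟙 ∘ S)) (length E) (begin
    ∑ (𝟙 ∘ S) + ∑ (𝟙 ∘ not ∘ S) ≡⟨ ∑-complement S ⟩
    length U                     ≤⟨ minimal E′ (deduplicate-! _≟_ (E ++ others) , dominatesAll) ⟩
    length E′                    ≤⟨ length-deduplicate _≟_ (E ++ others) ⟩
    length (E ++ others)         ≡⟨ length-++ E ⟩
    length E + length others     ≡⟨ cong (length E +_) length-others ⟩
    length E + ∑ (𝟙 ∘ not ∘ S)   ∎)
    where
    open ≤-Reasoning
    others : List (Fin (order G))
    others = map (lookup U) (filterᵇ (not ∘ S) (allFin (length U)))

    length-others : length others ≡ ∑ (𝟙 ∘ not ∘ S)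
    length-others =
      trans (length-map (lookup U) (filterᵇ (not ∘ S) (allFin (length U)))) (length-select (not ∘ S))

    E′ : List (Fin (order G))
    E′ = deduplicate _≟_ (E ++ others)

    dominatesAll : ∀ v → ∃ λ u → u ∈ E′ × Adj G v u
    dominatesAll v with S (part v) in inS
    ... | true  = let u , u∈E , adj = dominatesS v (from T-≡ inS)
                  in u , ∈-deduplicate⁺ _≟_ (∈-++⁺ˡ u∈E) , adj
    ... | false = lookup U (part v)
                , ∈-deduplicate⁺ _≟_ (∈-++⁺ʳ E (∈-map⁺ (lookup U)
                    (∈-filter⁺ (T? ∘ not ∘ S) (∈-allFin (part v)) (from T-not-≡ inS))))
                , adjacent-part v

Vertex : ∀ {m} → (Fin m → Graph) → Set
Vertex A = Grid (λ i → order (A i))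

ProductAdj : ∀ {m} (A : Fin m → Graph) → Vertex A → Vertex A → Set
ProductAdj {zero}  A x y = ⊥
ProductAdj {suc m} A (h , x) (h′ , x′) =
  (Adj (A zero) h h′ × x ≡ x′) ⊎ (h ≡ h′ × ProductAdj (A ∘ suc) x x′)

toGrid : ∀ {m} (A : Fin m → Graph) → BoxVertex A → Vertex A
toGrid {zero}  A v = tt
toGrid {suc m} A v = v zero , toGrid (A ∘ suc) (λ i → v (suc i))

fromGrid : ∀ {m} (A : Fin m → Graph) → Vertex A → BoxVertex A
fromGrid {suc m} A (h , x) zero    = h
fromGrid {suc m} A (h , x) (suc i) = fromGrid (A ∘ suc) x i

toGrid-fromGrid : ∀ {m} (A : Fin m → Graph) (x : Vertex A) → toGrid A (fromGrid A x) ≡ x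
toGrid-fromGrid {zero}  A tt      = refl
toGrid-fromGrid {suc m} A (h , x) = cong (h ,_) (toGrid-fromGrid (A ∘ suc) x)

toGrid-cong : ∀ {m} (A : Fin m → Graph) {u v : BoxVertex A} → (∀ j → u j ≡ v j) → toGrid A u ≡ toGrid A v
toGrid-cong {zero}  A e = refl
toGrid-cong {suc m} A e = cong₂ _,_ (e zero) (toGrid-cong (A ∘ suc) (e ∘ suc))

boxAdj⇒productAdj : ∀ {m} (A : Fin m → Graph) (u v : BoxVertex A)
  → BoxAdj A u v → ProductAdj A (toGrid A u) (toGrid A v)
boxAdj⇒productAdj {suc m} A u v (zero , adj , others) =
  inj₁ (adj , toGrid-cong (A ∘ suc) (λ j → others (suc j) (λ ())))
boxAdj⇒productAdj {suc m} A u v (suc i , adj , others) =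
  inj₂ (others zero (λ ()) , boxAdj⇒productAdj (A ∘ suc) (λ j → u (suc j)) (λ j → v (suc j))
         (i , adj , λ j j≢i → others (suc j) (j≢i ∘ suc-injective)))

-- Cells of the product partition and the main bound

cellOf : ∀ {m} {A : Fin m → Graph} {k : Fin m → ℕ}
  → (∀ i → DominationPartition (A i) (k i)) → Vertex A → Grid k
cellOf {zero}  P tt      = tt
cellOf {suc m} P (h , x) = DominationPartition.part (P zero) h , cellOf (P ∘ suc) x

DominatesCells : ∀ {m} {A : Fin m → Graph} {k : Fin m → ℕ}
  → (∀ i → DominationPartition (A i) (k i)) → (Grid k → Bool) → List (Vertex A) → Set
DominatesCells {A = A} P S D = ∀ x → T (S (cellOf P x)) → ∃ λ y → y ∈ D × ProductAdj A x y

module InductionStep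
  {m : ℕ} {A : Fin (suc m) → Graph} {k : Fin (suc m) → ℕ}
  (P : ∀ i → DominationPartition (A i) (k i))
  (adj? : Decidable (Adj (A zero))) (noIsolated : NoIsolated (A zero))
  (ih : ∀ S D → DominatesCells (P ∘ suc) S D → ∑ᴳ (k ∘ suc) (𝟙 ∘ S) ≤ m * length D)
  (S : Grid k → Bool) (D : List (Vertex A)) (dominated : DominatesCells P S D)
  where

  open DominationPartition (P zero) using (part; packing)

  V₀ : Set
  V₀ = Fin (order (A zero))

  Tail : Set
  Tail = Grid (k ∘ suc)

  over : Tail → Vertex A → Bool
  over J (_ , x) = does (gridEq? (k ∘ suc) (cellOf (P ∘ suc) x) J)

  over-own-cell : ∀ d → T (over (cellOf (P ∘ suc) (proj₂ d)) d)
  over-own-cell (_ , x) = T-does⁺ (gridEq? (k ∘ suc) (cellOf (P ∘ suc) x) (cellOf (P ∘ suc) x)) refl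

  covered : Tail → V₀ → Bool
  covered J h = any (λ d → over J d ∧ does (adj? h (proj₁ d))) D

  lacking : Tail → V₀ → Bool
  lacking J h = S (part h , J) ∧ not (covered J h)

  slice : Tail → List V₀
  slice J = map proj₁ (filterᵇ (over J) D) ++ map (proj₁ ∘ noIsolated) (filterᵇ (lacking J) (allFin _))

  slice-dominates : ∀ J v → T (S (part v , J)) → ∃ λ u → u ∈ slice J × Adj (A zero) v u
  slice-dominates J v inS with covered J v in isCovered
  ... | true  = let d , d∈D , t = find (any⁻ _ D (from T-≡ isCovered))
                    isOver , isAdj = to T-∧ t
                in proj₁ d
                 , ∈-++⁺ˡ (∈-map⁺ proj₁ (∈-filter⁺ (T? ∘ over J) d∈D isOver))
                 , T-does⁻ (adj? v (proj₁ d)) isAdj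
  ... | false = proj₁ (noIsolated v)
              , ∈-++⁺ʳ _ (∈-map⁺ (proj₁ ∘ noIsolated)
                  (∈-filter⁺ (T? ∘ lacking J) (∈-allFin v) (from T-∧ (inS , from T-not-≡ isCovered))))
              , proj₂ (noIsolated v)

  length-slice : ∀ J → length (slice J) ≡ ∑ᴸ (𝟙 ∘ over J) D + ∑ (𝟙 ∘ lacking J)
  length-slice J = trans (length-++ (map proj₁ (filterᵇ (over J) D)))
    (cong₂ _+_ (trans (length-map proj₁ (filterᵇ (over J) D)) (length-filterᵇ (over J) D))
               (trans (length-map (proj₁ ∘ noIsolated) (filterᵇ (lacking J) (allFin _)))
                      (length-select (lacking J))))

  hasHead : V₀ → Vertex A → Bool
  hasHead h d = does (proj₁ d ≟ h)

  fibre : V₀ → List (Vertex (A ∘ suc))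
  fibre h = map proj₂ (filterᵇ (hasHead h) D)

  -- A vertex (h , x) whose tail cell J has h lacking is dominated by some
  -- d ∈ D; d cannot differ from it in the first coordinate (then h would be
  -- covered), so d = (h , y) with y adjacent to x.
  fibre-dominates : ∀ h → DominatesCells (P ∘ suc) (λ J → lacking J h) (fibre h)
  fibre-dominates h x isLacking with to T-∧ isLacking
  ... | inS , notCovered with dominated (h , x) inS
  ... | (h′ , y) , d∈D , inj₁ (adj , refl) =
    ⊥-elim (T-not-T notCovered
      (any⁺ _ (lose d∈D (from T-∧ (over-own-cell (h′ , x) , T-does⁺ (adj? h h′) adj)))))
  ... | (h′ , y) , d∈D , inj₂ (refl , tailAdj) =
    y , ∈-map⁺ proj₂ (∈-filter⁺ (T? ∘ hasHead h) d∈D (T-does⁺ (h ≟ h) refl)) , tailAdj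

  ∑-over : ∑ᴳ (k ∘ suc) (λ J → ∑ᴸ (𝟙 ∘ over J) D) ≡ length D
  ∑-over = trans (∑ᴳ-∑ᴸ (k ∘ suc) (λ J → 𝟙 ∘ over J) D)
    (trans (∑ᴸ-cong D (λ d → ∑ᴳ-point (k ∘ suc) (cellOf (P ∘ suc) (proj₂ d)))) (∑ᴸ-length D))

  ∑-fibre : ∑ (λ h → length (fibre h)) ≡ length D
  ∑-fibre = trans (∑-cong (λ h → trans (length-map proj₂ (filterᵇ (hasHead h) D))
                                        (length-filterᵇ (hasHead h) D)))
    (trans (∑-∑ᴸ (λ h → 𝟙 ∘ hasHead h) D)
    (trans (∑ᴸ-cong D (λ d → ∑-point (proj₁ d))) (∑ᴸ-length D)))

  bound : ∑ᴳ k (𝟙 ∘ S) ≤ suc m * length D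
  bound = begin
    ∑ᴳ (k ∘ suc) (λ J → ∑ (λ l → 𝟙 (S (l , J))))
      ≤⟨ ∑ᴳ-mono (k ∘ suc) (λ J → packing (λ l → S (l , J)) (slice J) (slice-dominates J)) ⟩
    ∑ᴳ (k ∘ suc) (λ J → length (slice J))
      ≡⟨ ∑ᴳ-cong (k ∘ suc) length-slice ⟩
    ∑ᴳ (k ∘ suc) (λ J → ∑ᴸ (𝟙 ∘ over J) D + ∑ (𝟙 ∘ lacking J))
      ≡⟨ ∑ᴳ-+ (k ∘ suc) _ _ ⟩
    ∑ᴳ (k ∘ suc) (λ J → ∑ᴸ (𝟙 ∘ over J) D) + ∑ᴳ (k ∘ suc) (λ J → ∑ (𝟙 ∘ lacking J))
      ≡⟨ cong₂ _+_ ∑-over (∑ᴳ-∑ (k ∘ suc) (λ J → 𝟙 ∘ lacking J)) ⟩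
    length D + ∑ (λ h → ∑ᴳ (k ∘ suc) (λ J → 𝟙 (lacking J h)))
      ≤⟨ +-monoʳ-≤ (length D) (∑-mono (λ h → ih (λ J → lacking J h) (fibre h) (fibre-dominates h))) ⟩
    length D + ∑ (λ h → m * length (fibre h))
      ≡⟨ cong (length D +_) (trans (∑-* m (length ∘ fibre)) (cong (m *_) ∑-fibre)) ⟩
    length D + m * length D
      ∎
    where open ≤-Reasoning

cellBound : ∀ m {A : Fin m → Graph} {k : Fin m → ℕ} (P : ∀ i → DominationPartition (A i) (k i))
  → (∀ i → Decidable (Adj (A i))) → (∀ i → NoIsolated (A i))
  → (S : Grid k → Bool) (D : List (Vertex A)) → DominatesCells P S D
  → ∑ᴳ k (𝟙 ∘ S) ≤ m * length D
cellBound zero    P adj? noIsolated S D dominated with S tt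
... | false = z≤n
... | true  = ⊥-elim (proj₂ (proj₂ (dominated tt tt)))
cellBound (suc m) P adj? noIsolated S D dominated =
  InductionStep.bound P (adj? zero) (noIsolated zero)
    (cellBound m (P ∘ suc) (adj? ∘ suc) (noIsolated ∘ suc)) S D dominated

-- Classical decidability of adjacency

¬¬-Π : ∀ {a} {Q : Fin a → Set} → (∀ i → ¬ ¬ Q i) → ¬ ¬ (∀ i → Q i)
¬¬-Π {zero}  f k = k (λ ())
¬¬-Π {suc a} f k = f zero (λ q₀ → ¬¬-Π (f ∘ suc) (λ qs → k (λ { zero → q₀ ; (suc i) → qs i })))

¬¬-adjacencyDecidable : ∀ {n} (A : Fin n → Graph) → ¬ ¬ (∀ i → Decidable (Adj (A i)))
¬¬-adjacencyDecidable A = ¬¬-Π (λ i → ¬¬-Π (λ u → ¬¬-Π (λ v → ¬¬-excluded-middle)))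

theorem3 : (n : ℕ) → 1 ≤ n → (A : Fin n → Graph) → (∀ i → NoIsolated (A i))
    → (g : Fin n → ℕ) → (∀ i → IsTotalDominationNumber (Adj (A i)) (g i))
    → (γ : ℕ) → IsTotalDominationNumber (BoxAdj A) γ
    → prodFin g ≤ n * γ
theorem3 n _ A noIsolated g isγₜ _ ((D , (_ , dominatesD) , refl) , _) =
  decidable-stable (prodFin g ≤? n * length D) (λ ¬bound → ¬¬-adjacencyDecidable A (¬bound ∘ bound))
  where
  P : ∀ i → DominationPartition (A i) (g i)
  P i = dominationPartition (A i) (g i) (isγₜ i)

  D′ : List (Vertex A)
  D′ = map (toGrid A) D

  dominatesAll : DominatesCells P (λ _ → true) D′
  dominatesAll x _ with dominatesD (fromGrid A x)
  ... | u , u∈D , adj = toGrid A u , ∈-map⁺ (toGrid A) u∈D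
    , subst (λ z → ProductAdj A z (toGrid A u)) (toGrid-fromGrid A x) (boxAdj⇒productAdj A _ u adj)

  bound : (∀ i → Decidable (Adj (A i))) → prodFin g ≤ n * length D
  bound adj? = begin
    prodFin g                 ≡⟨ sym (trans (∑ᴳ-const g 1) (*-identityʳ (prodFin g))) ⟩
    ∑ᴳ g (λ _ → 1)            ≤⟨ cellBound n P adj? noIsolated (λ _ → true) D′ dominatesAll ⟩
    n * length D′             ≡⟨ cong (n *_) (length-map (toGrid A) D) ⟩
    n * length D              ∎
    where open ≤-Reasoning
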